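{- Let $H$ be a linear forest. If $G$ is an $H$-free graph and $(G,\mathcal Z)$ with $\mathcal Z=\{Z_1,\dots,Z_k\}$ is a yes-instance of Induced Disjoint Connected Subgraphs, then $(G,\mathcal Z)$ has a solution $(D^1,\dots,D^k)$ in which each $D^i$ has at most $(2|V(H)|-1)|Z_i|$ vertices.
   Context: A linear forest is a disjoint union of paths; $G$ is $H$-free if it has no induced subgraph isomorphic to $H$. Subgraphs $D^1,\dots,D^k$ of $G=(V,E)$ are mutually induced if there is $S\subseteq V$ with $G[S]=D^1+\dots+D^k$ (disjoint union). A terminal set collection is a family $\mathcal Z=\{Z_1,\dots,Z_k\}$ of pairwise disjoint nonempty vertex sets. Induced Disjoint Connected Subgraphs: given $G$ and $\mathcal Z$, decide whether $G$ has mutually induced connected subgraphs $D^1,\dots,D^k$ (a solution) with $Z_i\subseteq V(D^i)$ for all $i$. -}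

module Defs where

open import Data.Nat using (ℕ; zero; suc; _+_; _*_; _∸_; _≤_)
open import Data.Nat.Properties using (1+n≢n)
import Data.Nat as ℕ
open import Data.Bool using (Bool; true; false; _∨_; T)
open import Data.Bool.Properties using (∨-comm)
open import Data.Fin using (Fin; toℕ; splitAt)
open import Data.Fin.Subset using (Subset; _∈_; _⊆_; ∣_∣; Nonempty)
open import Data.List using (List; []; _∷_)
open import Data.List.Relation.Unary.All using (All)
open import Data.Sum using (_⊎_; inj₁; inj₂)
open import Data.Product using (Σ; _×_; _,_; ∃-syntax)
open import Relation.Nullary using (¬_; Dec; yes; no)
open import Relation.Nullary.Decidable using (⌊_⌋)
open import Relation.Binary.PropositionalEquality using (_≡_; refl; sym)
open import Function.Definitions using (Injective)

record Graph : Set where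
  field
    V      : ℕ
    E      : Fin V → Fin V → Bool
    E-sym  : ∀ x y → E x y ≡ E y x
    E-irr  : ∀ x → E x x ≡ false
open Graph public

private
  adjP : ∀ {m} → Fin m → Fin m → Bool
  adjP x y = ⌊ suc (toℕ x) ℕ.≟ toℕ y ⌋ ∨ ⌊ suc (toℕ y) ℕ.≟ toℕ x ⌋

  adjP-irr : ∀ {m} (x : Fin m) → adjP x x ≡ false
  adjP-irr x with suc (toℕ x) ℕ.≟ toℕ x
  ... | yes p = Data.Empty.⊥-elim (1+n≢n p)
    where import Data.Empty
  ... | no _ = refl

Path : ℕ → Graph
Path m = record
  { V = m ; E = adjP
  ; E-sym = λ x y → ∨-comm ⌊ suc (toℕ x) ℕ.≟ toℕ y ⌋ ⌊ suc (toℕ y) ℕ.≟ toℕ x ⌋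
  ; E-irr = adjP-irr }

private
  adjU : (G H : Graph) → Fin (V G + V H) → Fin (V G + V H) → Bool
  adjU G H x y with splitAt (V G) x | splitAt (V G) y
  ... | inj₁ a | inj₁ b = E G a b
  ... | inj₂ a | inj₂ b = E H a b
  ... | inj₁ _ | inj₂ _ = false
  ... | inj₂ _ | inj₁ _ = false

  adjU-sym : ∀ G H x y → adjU G H x y ≡ adjU G H y x
  adjU-sym G H x y with splitAt (V G) x | splitAt (V G) y
  ... | inj₁ a | inj₁ b = E-sym G a b
  ... | inj₂ a | inj₂ b = E-sym H a b
  ... | inj₁ _ | inj₂ _ = refl
  ... | inj₂ _ | inj₁ _ = refl

  adjU-irr : ∀ G H x → adjU G H x x ≡ false
  adjU-irr G H x with splitAt (V G) x
  ... | inj₁ a = E-irr G a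
  ... | inj₂ a = E-irr H a

_⊕_ : Graph → Graph → Graph
G ⊕ H = record { V = V G + V H ; E = adjU G H
               ; E-sym = adjU-sym G H ; E-irr = adjU-irr G H }

EmptyGraph : Graph
EmptyGraph = record { V = 0 ; E = λ () ; E-sym = λ () ; E-irr = λ () }

PathUnion : List ℕ → Graph
PathUnion []       = EmptyGraph
PathUnion (m ∷ ms) = Path m ⊕ PathUnion ms

record _≅_ (G H : Graph) : Set where
  field
    to      : Fin (V G) → Fin (V H)
    from    : Fin (V H) → Fin (V G)
    from-to : ∀ x → from (to x) ≡ x
    to-from : ∀ y → to (from y) ≡ y
    pres    : ∀ x y → E H (to x) (to y) ≡ E G x y

IsLinearForest : Graph → Set
IsLinearForest H = Σ (List ℕ) λ ms → All (1 ≤_) ms × (H ≅ PathUnion ms)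

ContainsInduced : (G H : Graph) → Set
ContainsInduced G H =
  Σ (Fin (V H) → Fin (V G)) λ f →
    Injective _≡_ _≡_ f × (∀ x y → E G (f x) (f y) ≡ E H x y)

_-Free_ : Graph → Graph → Set
H -Free G = ¬ ContainsInduced G H

data WalkIn (G : Graph) (D : Subset (V G)) : Fin (V G) → Fin (V G) → Set where
  here : ∀ {u} → u ∈ D → WalkIn G D u u
  step : ∀ {u w v} → u ∈ D → T (E G u w) → WalkIn G D w v → WalkIn G D u v

ConnectedIn : (G : Graph) → Subset (V G) → Set
ConnectedIn G D = Nonempty D × (∀ u v → u ∈ D → v ∈ D → WalkIn G D u v)

TerminalCollection : (G : Graph) (k : ℕ) → (Fin k → Subset (V G)) → Set
TerminalCollection G k Z =
  (∀ i → Nonempty (Z i)) ×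
  (∀ i j x → ¬ i ≡ j → x ∈ Z i → x ∈ Z j → Data.Empty.⊥)
  where import Data.Empty

-- A solution, given by the vertex sets of D¹,…,Dᵏ: each G[Dⁱ] is connected
-- and contains Zᵢ, and the Dⁱ are mutually induced, i.e. pairwise disjoint
-- with no edges between distinct Dⁱ, Dʲ (so G[⋃ Dⁱ] = D¹ + … + Dᵏ).
IsSolution : (G : Graph) (k : ℕ) → (Fin k → Subset (V G)) → (Fin k → Subset (V G)) → Set
IsSolution G k Z D =
  (∀ i → Z i ⊆ D i) ×
  (∀ i → ConnectedIn G (D i)) ×
  (∀ i j → ¬ i ≡ j → ∀ x → x ∈ D i → x ∈ D j → Data.Empty.⊥) ×
  (∀ i j → ¬ i ≡ j → ∀ x y → x ∈ D i → y ∈ D j → E G x y ≡ false)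
  where import Data.Empty

IsYesInstance : (G : Graph) (k : ℕ) → (Fin k → Subset (V G)) → Set
IsYesInstance G k Z = Σ (Fin k → Subset (V G)) λ D → IsSolution G k Z D

module Submission where

-- Fix r ∈ Zᵢ and, for every z ∈ Zᵢ, shortcut a walk from z to r in G[Dⁱ] to an
-- induced path. The union of these paths is a connected subset of Dⁱ containing
-- Zᵢ, so substituting it for Dⁱ keeps a solution. If H ≅ P_{m₁} + … + P_{mᵣ}, an
-- induced path on Σ (mⱼ + 1) ≤ 2|V(H)| vertices contains H as an induced
-- subgraph (take the paths one after another, skipping one vertex between
-- them), so in an H-free graph every induced path has at most 2|V(H)| − 1
-- vertices.

open import Defs
open import Level using (0ℓ)
open import Function using (_∘_)
open import Function.Bundles using (Equivalence)
open import Function.Definitions using (Injective)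
open import Data.Empty using (⊥-elim)
open import Data.Bool using (Bool; false; _∨_; T)
open import Data.Bool.Properties using (∨-comm; T-≡; ¬-not)
open import Data.Nat using (ℕ; zero; suc; _+_; _*_; _∸_; _≤_; _<_; _≡ᵇ_; _≟_; z≤n; s≤s; _≤?_)
open import Data.Nat.Properties
open import Data.Nat.Tactic.RingSolver using (solve-∀)
open import Data.Fin using (Fin; zero; suc; toℕ; fromℕ<; splitAt; join)
open import Data.Fin.Properties
  using (toℕ<n; toℕ-fromℕ<; toℕ-injective; join-splitAt; injective⇒≤) renaming (_≟_ to _≟ᶠ_)
open import Data.Fin.Subset using (Subset; _∈_; _⊆_; ∣_∣; ⁅_⁆; _∪_; ⊥; inside; outside)
open import Data.Fin.Subset.Properties
  using (p⊆p∪q; q⊆p∪q; x∈p∪q⁻; x∈⁅x⁆; x∈⁅y⁆⇒x≡y; ∉⊥; ∣⊥∣≡0; ∣⁅x⁆∣≡1)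
open import Data.Vec.Base using ([]; _∷_; here; there)
open import Data.List using (List; []; _∷_; length; lookup; last)
open import Data.List.Membership.Propositional using () renaming (_∈_ to _∈ₗ_)
open import Data.List.Membership.Propositional.Properties using (∈-lookup)
open import Data.List.Relation.Unary.All using (All; []; _∷_)
import Data.List.Relation.Unary.All as All
open import Data.List.Relation.Unary.All.Properties.Core using (¬Any⇒All¬)
open import Data.List.Relation.Unary.Any using (Any; here; there; any?)
open import Data.Maybe using (just)
open import Data.Product using (Σ; _×_; _,_; proj₂)
open import Data.Sum using (_⊎_; inj₁; inj₂)
open import Relation.Nullary using (¬_; Dec; _⊎-dec_)
open import Relation.Nullary.Decidable using (isYes≗does; T?; yes; no)
open import Relation.Unary using (Pred)
open import Relation.Binary.PropositionalEquality

consecutive : ℕ → ℕ → Bool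
consecutive m n = (suc m ≡ᵇ n) ∨ (suc n ≡ᵇ m)

Path-adjacency : ∀ {n} (i j : Fin n) → E (Path n) i j ≡ consecutive (toℕ i) (toℕ j)
Path-adjacency i j =
  cong₂ _∨_ (isYes≗does (suc (toℕ i) ≟ toℕ j)) (isYes≗does (suc (toℕ j) ≟ toℕ i))

consecutive-sym : ∀ m n → consecutive m n ≡ consecutive n m
consecutive-sym m n = ∨-comm (suc m ≡ᵇ n) (suc n ≡ᵇ m)

consecutive-+ : ∀ s m n → consecutive (s + m) (s + n) ≡ consecutive m n
consecutive-+ zero    m n = refl
consecutive-+ (suc s) m n = consecutive-+ s m n

consecutive-far : ∀ {m n} → suc m < n → consecutive m n ≡ false
consecutive-far {zero}  {suc zero}    (s≤s ())
consecutive-far {zero}  {suc (suc n)} _ = refl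
consecutive-far {suc m} {suc n} (s≤s lt) = consecutive-far lt

splitAt-injective : ∀ m {n} {x y : Fin (m + n)} → splitAt m x ≡ splitAt m y → x ≡ y
splitAt-injective m {n} {x} {y} eq = begin
  x                     ≡⟨ join-splitAt m n x ⟨
  join m n (splitAt m x) ≡⟨ cong (join m n) eq ⟩
  join m n (splitAt m y) ≡⟨ join-splitAt m n y ⟩
  y                     ∎
  where open ≡-Reasoning

-- The paths of P_{m₁} + … + P_{mᵣ} laid out one after another on ℕ, each
-- followed by one unused number, so that distinct paths are never consecutive.
span : List ℕ → ℕ
span []       = 0
span (m ∷ ms) = suc m + span ms

place : ∀ ms → ℕ → Fin (V (PathUnion ms)) → ℕ
place (m ∷ ms) s x with splitAt m x
... | inj₁ a = s + toℕ a
... | inj₂ b = place ms (s + suc m) b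

place-≥ : ∀ ms s x → s ≤ place ms s x
place-≥ (m ∷ ms) s x with splitAt m x
... | inj₁ a = m≤m+n s (toℕ a)
... | inj₂ b = ≤-trans (m≤m+n s (suc m)) (place-≥ ms (s + suc m) b)

place-< : ∀ ms s x → place ms s x < s + span ms
place-< (m ∷ ms) s x with splitAt m x
... | inj₁ a = +-monoʳ-< s (<-≤-trans (m<n⇒m<1+n (toℕ<n a)) (m≤m+n (suc m) (span ms)))
... | inj₂ b = subst (place ms (s + suc m) b <_) (+-assoc s (suc m) (span ms))
                     (place-< ms (s + suc m) b)

first-path-before-gap : ∀ ms s m (a : Fin m) b → suc (s + toℕ a) < place ms (s + suc m) b
first-path-before-gap ms s m a b = ≤-trans (s≤s (+-monoʳ-< s (toℕ<n a)))
  (≤-trans (≤-reflexive (sym (+-suc s m))) (place-≥ ms (s + suc m) b))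

place-consecutive : ∀ ms s x y → consecutive (place ms s x) (place ms s y) ≡ E (PathUnion ms) x y
place-consecutive (m ∷ ms) s x y with splitAt m x | splitAt m y
... | inj₁ a | inj₁ b = trans (consecutive-+ s (toℕ a) (toℕ b)) (sym (Path-adjacency a b))
... | inj₂ a | inj₂ b = place-consecutive ms (s + suc m) a b
... | inj₁ a | inj₂ b = consecutive-far (first-path-before-gap ms s m a b)
... | inj₂ a | inj₁ b = trans (consecutive-sym (place ms (s + suc m) a) (s + toℕ b))
                              (consecutive-far (first-path-before-gap ms s m b a))

place-injective : ∀ ms s {x y} → place ms s x ≡ place ms s y → x ≡ y
place-injective (m ∷ ms) s {x} {y} eq with splitAt m x in ex | splitAt m y in ey
... | inj₁ a | inj₁ b = splitAt-injective m (trans ex (trans (cong inj₁ a≡b) (sym ey)))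
  where a≡b = toℕ-injective (+-cancelˡ-≡ s _ _ eq)
... | inj₂ a | inj₂ b = splitAt-injective m (trans ex (trans (cong inj₂ a≡b) (sym ey)))
  where a≡b = place-injective ms (s + suc m) eq
... | inj₁ a | inj₂ b =
  ⊥-elim (<-irrefl eq (<-trans (n<1+n _) (first-path-before-gap ms s m a b)))
... | inj₂ a | inj₁ b =
  ⊥-elim (<-irrefl (sym eq) (<-trans (n<1+n _) (first-path-before-gap ms s m b a)))

span≤2*order : ∀ {ms} → All (1 ≤_) ms → span ms ≤ 2 * V (PathUnion ms)
span≤2*order {[]}     []       = ≤-refl
span≤2*order {m ∷ ms} (p ∷ ps) = begin
  suc m + span ms              ≤⟨ +-mono-≤ (+-monoˡ-≤ m p) (span≤2*order ps) ⟩
  m + m + 2 * V (PathUnion ms) ≡⟨ double-+ m (V (PathUnion ms)) ⟩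
  2 * (m + V (PathUnion ms))   ∎
  where
  open ≤-Reasoning
  double-+ : ∀ m n → m + m + 2 * n ≡ 2 * (m + n)
  double-+ = solve-∀

ContainsInduced-trans : ∀ {G K H} → ContainsInduced G K → ContainsInduced K H → ContainsInduced G H
ContainsInduced-trans (f , f-inj , f-pres) (g , g-inj , g-pres) =
  f ∘ g , g-inj ∘ f-inj , λ x y → trans (f-pres (g x) (g y)) (g-pres x y)

ContainsInduced⇒order≤ : ∀ {G H} → ContainsInduced G H → V H ≤ V G
ContainsInduced⇒order≤ (_ , f-inj , _) = injective⇒≤ f-inj

≅⇒ContainsInduced : ∀ {G H} → G ≅ H → ContainsInduced H G
≅⇒ContainsInduced iso = to , to-injective , pres
  where
  open _≅_ iso
  to-injective : Injective _≡_ _≡_ to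
  to-injective {x} {y} eq = trans (sym (from-to x)) (trans (cong from eq) (from-to y))

≅-sym : ∀ {G H} → G ≅ H → H ≅ G
≅-sym {G} {H} iso = record
  { to = from ; from = to ; from-to = to-from ; to-from = from-to
  ; pres = λ x y → trans (sym (pres (from x) (from y))) (cong₂ (E H) (to-from x) (to-from y)) }
  where open _≅_ iso

Path-contains-PathUnion : ∀ {n} ms → span ms ≤ n → ContainsInduced (Path n) (PathUnion ms)
Path-contains-PathUnion {n} ms fits = embed , embed-injective , embed-adjacency
  where
  placed : ∀ x → place ms 0 x < n
  placed x = <-≤-trans (place-< ms 0 x) fits
  embed : Fin (V (PathUnion ms)) → Fin n
  embed x = fromℕ< (placed x)
  toℕ-embed : ∀ x → toℕ (embed x) ≡ place ms 0 x
  toℕ-embed x = toℕ-fromℕ< (placed x)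
  embed-injective : ∀ {x y} → embed x ≡ embed y → x ≡ y
  embed-injective {x} {y} eq =
    place-injective ms 0 (trans (sym (toℕ-embed x)) (trans (cong toℕ eq) (toℕ-embed y)))
  embed-adjacency : ∀ x y → E (Path n) (embed x) (embed y) ≡ E (PathUnion ms) x y
  embed-adjacency x y = begin
    E (Path n) (embed x) (embed y)                   ≡⟨ Path-adjacency (embed x) (embed y) ⟩
    consecutive (toℕ (embed x)) (toℕ (embed y))     ≡⟨ cong₂ consecutive (toℕ-embed x) (toℕ-embed y) ⟩
    consecutive (place ms 0 x) (place ms 0 y)       ≡⟨ place-consecutive ms 0 x y ⟩
    E (PathUnion ms) x y                             ∎
    where open ≡-Reasoning

Near : (G : Graph) → Fin (V G) → Fin (V G) → Set
Near G x z = x ≡ z ⊎ T (E G x z)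

Near? : (G : Graph) → ∀ x z → Dec (Near G x z)
Near? G x z = (x ≟ᶠ z) ⊎-dec T? (E G x z)

data IsInducedPath (G : Graph) : List (Fin (V G)) → Set where
  [-]  : ∀ {x} → IsInducedPath G (x ∷ [])
  link : ∀ {x y ys} → T (E G x y) → All (¬_ ∘ Near G x) ys →
         IsInducedPath G (y ∷ ys) → IsInducedPath G (x ∷ y ∷ ys)

module _ {G : Graph} where

  private
    ¬T⇒≡false : ∀ {b} → ¬ T b → b ≡ false
    ¬T⇒≡false ¬b = ¬-not (¬b ∘ Equivalence.from T-≡)

  head-adjacency : ∀ {x y ys} → T (E G x y) → All (¬_ ∘ Near G x) ys →
                   ∀ j → E G x (lookup (x ∷ y ∷ ys) j) ≡ consecutive 0 (toℕ j)
  head-adjacency {x} _ _   zero          = E-irr G x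
  head-adjacency     e _   (suc zero)    = Equivalence.to T-≡ e
  head-adjacency     _ far (suc (suc j)) =
    ¬T⇒≡false (λ e → All.lookup far (∈-lookup j) (inj₂ e))

  inducedPath-adjacency : ∀ {P} → IsInducedPath G P →
                          ∀ i j → E G (lookup P i) (lookup P j) ≡ consecutive (toℕ i) (toℕ j)
  inducedPath-adjacency {x ∷ []} [-] zero zero = E-irr G x
  inducedPath-adjacency (link e far _) zero    j    = head-adjacency e far j
  inducedPath-adjacency (link e far _) (suc i) zero =
    trans (E-sym G _ _) (trans (head-adjacency e far (suc i)) (consecutive-sym 0 (suc (toℕ i))))
  inducedPath-adjacency (link _ _ path) (suc i) (suc j) = inducedPath-adjacency path i j

  head-unique : ∀ {x y ys} → T (E G x y) → All (¬_ ∘ Near G x) ys →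
                ∀ j → x ≡ lookup (x ∷ y ∷ ys) j → j ≡ zero
  head-unique     _ _   zero          _  = refl
  head-unique {x} e _   (suc zero)    eq = ⊥-elim (subst T (E-irr G x) (subst (T ∘ E G x) (sym eq) e))
  head-unique     _ far (suc (suc j)) eq = ⊥-elim (All.lookup far (∈-lookup j) (inj₁ eq))

  inducedPath-lookup-injective : ∀ {P} → IsInducedPath G P → Injective _≡_ _≡_ (lookup P)
  inducedPath-lookup-injective [-] {zero} {zero} _ = refl
  inducedPath-lookup-injective (link e far _) {zero}  {j}     eq = sym (head-unique e far j eq)
  inducedPath-lookup-injective (link e far _) {suc i} {zero}  eq = head-unique e far (suc i) (sym eq)
  inducedPath-lookup-injective (link _ _ path) {suc i} {suc j} eq =
    cong suc (inducedPath-lookup-injective path eq)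

  inducedPath⇒ContainsPath : ∀ {P} → IsInducedPath G P → ContainsInduced G (Path (length P))
  inducedPath⇒ContainsPath {P} path =
    lookup P , inducedPath-lookup-injective path ,
    λ i j → trans (inducedPath-adjacency path i j) (sym (Path-adjacency i j))

  inducedPath-length≤ : ∀ {H} → IsLinearForest H → H -Free G →
                        ∀ {P} → IsInducedPath G P → length P ≤ 2 * V H ∸ 1
  inducedPath-length≤ {H} (ms , nonempty , H≅) free {P} path with span ms ≤? length P
  ... | yes fits =
    ⊥-elim (free (ContainsInduced-trans {G} {PathUnion ms} {H} G⊇PathUnion (≅⇒ContainsInduced H≅)))
    where
    G⊇PathUnion : ContainsInduced G (PathUnion ms)
    G⊇PathUnion = ContainsInduced-trans {G} {Path (length P)} {PathUnion ms}
                    (inducedPath⇒ContainsPath path) (Path-contains-PathUnion ms fits)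
  ... | no short = suc[m]≤n⇒m≤pred[n] (begin-strict
    length P                  <⟨ ≰⇒> short ⟩
    span ms                   ≤⟨ span≤2*order nonempty ⟩
    2 * V (PathUnion ms)      ≤⟨ *-monoʳ-≤ 2 PathUnion≤H ⟩
    2 * V H                   ∎)
    where
    open ≤-Reasoning
    PathUnion≤H : V (PathUnion ms) ≤ V H
    PathUnion≤H = ContainsInduced⇒order≤ {H} {PathUnion ms} (≅⇒ContainsInduced (≅-sym H≅))

module _ {G : Graph} where

  walk-source∈ : ∀ {A u v} → WalkIn G A u v → u ∈ A
  walk-source∈ (here u∈A)     = u∈A
  walk-source∈ (step u∈A _ _) = u∈A

  walk-mono : ∀ {A B u v} → A ⊆ B → WalkIn G A u v → WalkIn G B u v
  walk-mono A⊆B (here u∈A)       = here (A⊆B u∈A)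
  walk-mono A⊆B (step u∈A e w)   = step (A⊆B u∈A) e (walk-mono A⊆B w)

  _++ʷ_ : ∀ {A u w v} → WalkIn G A u w → WalkIn G A w v → WalkIn G A u v
  here _       ++ʷ w′ = w′
  step u∈A e w ++ʷ w′ = step u∈A e (w ++ʷ w′)

  walk-reverse : ∀ {A u v} → WalkIn G A u v → WalkIn G A v u
  walk-reverse (here u∈A) = here u∈A
  walk-reverse {u = u} (step {w = w} u∈A e rest) =
    walk-reverse rest ++ʷ step (walk-source∈ rest) (subst T (E-sym G u w) e) (here u∈A)

  connected-via-root : ∀ {A r} → r ∈ A → (∀ x → x ∈ A → WalkIn G A x r) → ConnectedIn G A
  connected-via-root {r = r} r∈A toRoot =
    (r , r∈A) , λ u v u∈A v∈A → toRoot u u∈A ++ʷ walk-reverse (toRoot v v∈A)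

  -- Prepend u to L after dropping everything before the last vertex of L equal or adjacent to u.
  attach : Fin (V G) → List (Fin (V G)) → List (Fin (V G))
  attach u [] = u ∷ []
  attach u (x ∷ xs) with any? (Near? G u) xs
  ... | yes _ = attach u xs
  ... | no _ with u ≟ᶠ x
  ...   | yes _ = x ∷ xs
  ...   | no _  = u ∷ x ∷ xs

  attach-induced : ∀ u L → IsInducedPath G L → Any (Near G u) L → IsInducedPath G (attach u L)
  attach-induced u (x ∷ xs) path near with any? (Near? G u) xs
  attach-induced u (x ∷ xs)     (link _ _ path) _ | yes near′ = attach-induced u xs path near′
  attach-induced u (x ∷ [])     [-]             _ | yes ()
  ... | no far with u ≟ᶠ x
  ...   | yes _   = path
  ...   | no u≢x  = link (adjacent near) (¬Any⇒All¬ xs far) path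
    where
    adjacent : Any (Near G u) (x ∷ xs) → T (E G u x)
    adjacent (here (inj₁ u≡x)) = ⊥-elim (u≢x u≡x)
    adjacent (here (inj₂ e))   = e
    adjacent (there near′)     = ⊥-elim (far near′)

  attach-all : ∀ {Q : Pred (Fin (V G)) 0ℓ} u L → Q u → All Q L → All Q (attach u L)
  attach-all u []       qu []          = qu ∷ []
  attach-all u (x ∷ xs) qu (qx ∷ qxs) with any? (Near? G u) xs
  ... | yes _ = attach-all u xs qu qxs
  ... | no _ with u ≟ᶠ x
  ...   | yes _ = qx ∷ qxs
  ...   | no _  = qu ∷ qx ∷ qxs

  attach-head : ∀ u L → Σ (List (Fin (V G))) λ rest → attach u L ≡ u ∷ rest
  attach-head u [] = [] , refl
  attach-head u (x ∷ xs) with any? (Near? G u) xs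
  ... | yes _ = attach-head u xs
  ... | no _ with u ≟ᶠ x
  ...   | yes refl = xs , refl
  ...   | no _     = x ∷ xs , refl

  attach-last : ∀ {v} u L → last L ≡ just v → last (attach u L) ≡ just v
  attach-last u (x ∷ xs) ends with any? (Near? G u) xs
  attach-last u (x ∷ [])     ends | yes ()
  attach-last u (x ∷ y ∷ ys) ends | yes _ = attach-last u (y ∷ ys) ends
  ... | no _ with u ≟ᶠ x
  ...   | yes _ = ends
  ...   | no _  = ends

  shortcut : ∀ {A u v} → WalkIn G A u v → List (Fin (V G))
  shortcut (here {u} _)     = u ∷ []
  shortcut (step {u} _ _ w) = attach u (shortcut w)

  shortcut-head : ∀ {A u v} (w : WalkIn G A u v) →
                  Σ (List (Fin (V G))) λ rest → shortcut w ≡ u ∷ rest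
  shortcut-head (here _)         = [] , refl
  shortcut-head (step {u} _ _ w) = attach-head u (shortcut w)

  shortcut-induced : ∀ {A u v} (w : WalkIn G A u v) → IsInducedPath G (shortcut w)
  shortcut-induced (here _) = [-]
  shortcut-induced (step {u} _ e w) with shortcut-head w
  ... | _ , starts = attach-induced u (shortcut w) (shortcut-induced w)
                       (subst (Any (Near G u)) (sym starts) (here (inj₂ e)))

  shortcut-⊆ : ∀ {A u v} (w : WalkIn G A u v) → All (_∈ A) (shortcut w)
  shortcut-⊆ (here u∈A)         = u∈A ∷ []
  shortcut-⊆ (step {u} u∈A _ w) = attach-all u (shortcut w) u∈A (shortcut-⊆ w)

  shortcut-last : ∀ {A u v} (w : WalkIn G A u v) → last (shortcut w) ≡ just v
  shortcut-last (here _)         = refl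
  shortcut-last (step {u} _ _ w) = attach-last u (shortcut w) (shortcut-last w)

fromList : ∀ {n} → List (Fin n) → Subset n
fromList []       = ⊥
fromList (x ∷ xs) = ⁅ x ⁆ ∪ fromList xs

∈-fromList⁺ : ∀ {n} {x : Fin n} xs → x ∈ₗ xs → x ∈ fromList xs
∈-fromList⁺ (y ∷ ys) (here refl)  = p⊆p∪q (fromList ys) (x∈⁅x⁆ y)
∈-fromList⁺ (y ∷ ys) (there x∈ys) = q⊆p∪q ⁅ y ⁆ (fromList ys) (∈-fromList⁺ ys x∈ys)

∈-fromList⁻ : ∀ {n} {x : Fin n} xs → x ∈ fromList xs → x ∈ₗ xs
∈-fromList⁻ []       x∈⊥ = ⊥-elim (∉⊥ x∈⊥)
∈-fromList⁻ (y ∷ ys) x∈  with x∈p∪q⁻ ⁅ y ⁆ (fromList ys) x∈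
... | inj₁ x∈⁅y⁆ = here (x∈⁅y⁆⇒x≡y y x∈⁅y⁆)
... | inj₂ x∈ys  = there (∈-fromList⁻ ys x∈ys)

∣p∪q∣≤∣p∣+∣q∣ : ∀ {n} (p q : Subset n) → ∣ p ∪ q ∣ ≤ ∣ p ∣ + ∣ q ∣
∣p∪q∣≤∣p∣+∣q∣ []            []            = z≤n
∣p∪q∣≤∣p∣+∣q∣ (inside ∷ p)  (inside ∷ q)  =
  s≤s (≤-trans (m≤n⇒m≤1+n (∣p∪q∣≤∣p∣+∣q∣ p q)) (≤-reflexive (sym (+-suc ∣ p ∣ ∣ q ∣))))
∣p∪q∣≤∣p∣+∣q∣ (inside ∷ p)  (outside ∷ q) = s≤s (∣p∪q∣≤∣p∣+∣q∣ p q)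
∣p∪q∣≤∣p∣+∣q∣ (outside ∷ p) (inside ∷ q)  =
  ≤-trans (s≤s (∣p∪q∣≤∣p∣+∣q∣ p q)) (≤-reflexive (sym (+-suc ∣ p ∣ ∣ q ∣)))
∣p∪q∣≤∣p∣+∣q∣ (outside ∷ p) (outside ∷ q) = ∣p∪q∣≤∣p∣+∣q∣ p q

∣fromList∣≤length : ∀ {n} (xs : List (Fin n)) → ∣ fromList xs ∣ ≤ length xs
∣fromList∣≤length {n} [] = ≤-reflexive (∣⊥∣≡0 n)
∣fromList∣≤length (x ∷ xs) = begin
  ∣ ⁅ x ⁆ ∪ fromList xs ∣       ≤⟨ ∣p∪q∣≤∣p∣+∣q∣ ⁅ x ⁆ (fromList xs) ⟩
  ∣ ⁅ x ⁆ ∣ + ∣ fromList xs ∣   ≤⟨ +-mono-≤ (≤-reflexive (∣⁅x⁆∣≡1 x)) (∣fromList∣≤length xs) ⟩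
  1 + length xs                 ∎
  where open ≤-Reasoning

⋃[_] : ∀ {m n} (p : Subset m) → (∀ z → z ∈ p → Subset n) → Subset n
⋃[ [] ]          S = ⊥
⋃[ inside  ∷ p ] S = S zero here ∪ ⋃[ p ] (λ z z∈p → S (suc z) (there z∈p))
⋃[ outside ∷ p ] S = ⋃[ p ] (λ z z∈p → S (suc z) (there z∈p))

∈-⋃⁺ : ∀ {m n} (p : Subset m) (S : ∀ z → z ∈ p → Subset n) {z x} (z∈p : z ∈ p) →
       x ∈ S z z∈p → x ∈ ⋃[ p ] S
∈-⋃⁺ (inside  ∷ p) S here          x∈ = p⊆p∪q (⋃[ p ] _) x∈
∈-⋃⁺ (inside  ∷ p) S (there z∈p)   x∈ = q⊆p∪q (S zero here) (⋃[ p ] _) (∈-⋃⁺ p _ z∈p x∈)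
∈-⋃⁺ (outside ∷ p) S (there z∈p)   x∈ = ∈-⋃⁺ p _ z∈p x∈

∈-⋃⁻ : ∀ {m n} (p : Subset m) (S : ∀ z → z ∈ p → Subset n) {x} →
       x ∈ ⋃[ p ] S → Σ (Fin m) λ z → Σ (z ∈ p) λ z∈p → x ∈ S z z∈p
∈-⋃⁻ []            S x∈ = ⊥-elim (∉⊥ x∈)
∈-⋃⁻ (inside ∷ p)  S x∈ with x∈p∪q⁻ (S zero here) (⋃[ p ] _) x∈
... | inj₁ x∈S = zero , here , x∈S
... | inj₂ x∈⋃ with ∈-⋃⁻ p _ x∈⋃
...   | z , z∈p , x∈S = suc z , there z∈p , x∈S
∈-⋃⁻ (outside ∷ p) S x∈ with ∈-⋃⁻ p _ x∈
... | z , z∈p , x∈S = suc z , there z∈p , x∈S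

∣⋃∣≤ : ∀ {m n} c (p : Subset m) (S : ∀ z → z ∈ p → Subset n) →
       (∀ z z∈p → ∣ S z z∈p ∣ ≤ c) → ∣ ⋃[ p ] S ∣ ≤ c * ∣ p ∣
∣⋃∣≤ {n = n} c [] S _ = ≤-trans (≤-reflexive (∣⊥∣≡0 n)) z≤n
∣⋃∣≤ c (inside ∷ p) S bounded = begin
  ∣ S zero here ∪ ⋃[ p ] _ ∣         ≤⟨ ∣p∪q∣≤∣p∣+∣q∣ (S zero here) (⋃[ p ] _) ⟩
  ∣ S zero here ∣ + ∣ ⋃[ p ] _ ∣     ≤⟨ +-mono-≤ (bounded zero here) (∣⋃∣≤ c p _ bounded-tail) ⟩
  c + c * ∣ p ∣                      ≡⟨ *-suc c ∣ p ∣ ⟨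
  c * suc ∣ p ∣                      ∎
  where
  open ≤-Reasoning
  bounded-tail : ∀ z z∈p → ∣ S (suc z) (there z∈p) ∣ ≤ c
  bounded-tail z z∈p = bounded (suc z) (there z∈p)
∣⋃∣≤ c (outside ∷ p) S bounded = ∣⋃∣≤ c p _ λ z z∈p → bounded (suc z) (there z∈p)

record SmallConnector (G : Graph) (D Z : Subset (V G)) (c : ℕ) : Set where
  field
    vertices  : Subset (V G)
    Z⊆        : Z ⊆ vertices
    ⊆D        : vertices ⊆ D
    connected : ConnectedIn G vertices
    small     : ∣ vertices ∣ ≤ c * ∣ Z ∣

module _ {G : Graph} where

  inducedPath-walk-to-last : ∀ {P v x} → IsInducedPath G P → last P ≡ just v → x ∈ₗ P →
                             WalkIn G (fromList P) x v
  inducedPath-walk-to-last {P@(_ ∷ [])} [-] refl (here refl) = here (∈-fromList⁺ P (here refl))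
  inducedPath-walk-to-last {P@(y ∷ z ∷ zs)} (link e _ path) ends (here refl) =
    step (∈-fromList⁺ P (here refl)) e
         (walk-mono (q⊆p∪q ⁅ y ⁆ (fromList (z ∷ zs))) (inducedPath-walk-to-last path ends (here refl)))
  inducedPath-walk-to-last {y ∷ z ∷ zs} (link _ _ path) ends (there x∈) =
    walk-mono (q⊆p∪q ⁅ y ⁆ (fromList (z ∷ zs))) (inducedPath-walk-to-last path ends x∈)

  smallConnector : ∀ {c} → (∀ {P} → IsInducedPath G P → length P ≤ c) →
                      ∀ {D Z r} → ConnectedIn G D → Z ⊆ D → r ∈ Z → SmallConnector G D Z c
  smallConnector {c} short {D} {Z} {r} (_ , walk) Z⊆D r∈Z = record
    { vertices  = D′
    ; Z⊆        = Z⊆D′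
    ; ⊆D        = D′⊆D
    ; connected = connected-via-root (Z⊆D′ r∈Z) toRoot
    ; small     = ∣⋃∣≤ c Z routeSet route-small
    }
    where
    walkToRoot : ∀ z → z ∈ Z → WalkIn G D z r
    walkToRoot z z∈Z = walk z r (Z⊆D z∈Z) (Z⊆D r∈Z)
    route : ∀ z → z ∈ Z → List (Fin (V G))
    route z z∈Z = shortcut (walkToRoot z z∈Z)
    route-induced : ∀ z z∈Z → IsInducedPath G (route z z∈Z)
    route-induced z z∈Z = shortcut-induced (walkToRoot z z∈Z)
    routeSet : ∀ z → z ∈ Z → Subset (V G)
    routeSet z z∈Z = fromList (route z z∈Z)
    route-small : ∀ z z∈Z → ∣ routeSet z z∈Z ∣ ≤ c
    route-small z z∈Z = ≤-trans (∣fromList∣≤length (route z z∈Z)) (short (route-induced z z∈Z))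
    D′ : Subset (V G)
    D′ = ⋃[ Z ] routeSet

    Z⊆D′ : Z ⊆ D′
    Z⊆D′ {z} z∈Z with shortcut-head (walkToRoot z z∈Z)
    ... | _ , starts =
      ∈-⋃⁺ Z routeSet z∈Z (∈-fromList⁺ (route z z∈Z) (subst (z ∈ₗ_) (sym starts) (here refl)))

    D′⊆D : D′ ⊆ D
    D′⊆D x∈ with ∈-⋃⁻ Z routeSet x∈
    ... | z , z∈Z , x∈route =
      All.lookup (shortcut-⊆ (walkToRoot z z∈Z)) (∈-fromList⁻ (route z z∈Z) x∈route)

    toRoot : ∀ x → x ∈ D′ → WalkIn G D′ x r
    toRoot x x∈ with ∈-⋃⁻ Z routeSet x∈
    ... | z , z∈Z , x∈route =
      walk-mono (∈-⋃⁺ Z routeSet z∈Z)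
        (inducedPath-walk-to-last (route-induced z z∈Z) (shortcut-last (walkToRoot z z∈Z))
                                  (∈-fromList⁻ (route z z∈Z) x∈route))

IsSolution-⊆ : ∀ {G k Z D} D′ → IsSolution G k Z D → (∀ i → D′ i ⊆ D i) →
               (∀ i → Z i ⊆ D′ i) → (∀ i → ConnectedIn G (D′ i)) → IsSolution G k Z D′
IsSolution-⊆ D′ (_ , _ , disjoint , separated) D′⊆D Z⊆D′ connected′ =
  Z⊆D′ , connected′ ,
  (λ i j i≢j x x∈i x∈j → disjoint i j i≢j x (D′⊆D i x∈i) (D′⊆D j x∈j)) ,
  (λ i j i≢j x y x∈i y∈j → separated i j i≢j x y (D′⊆D i x∈i) (D′⊆D j y∈j))

lemma4 : (H : Graph) → IsLinearForest H →
         (G : Graph) → H -Free G →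
         (k : ℕ) (Z : Fin k → Subset (V G)) → TerminalCollection G k Z →
         IsYesInstance G k Z →
         Σ (Fin k → Subset (V G)) λ D →
           IsSolution G k Z D × (∀ i → ∣ D i ∣ ≤ (2 * V H ∸ 1) * ∣ Z i ∣)
lemma4 H forest G free k Z (nonempty , _) (D , solution@(Z⊆D , D-connected , _)) =
  vertices ∘ shrink ,
  IsSolution-⊆ (vertices ∘ shrink) solution (λ i → ⊆D (shrink i)) (λ i → Z⊆ (shrink i))
               (connected ∘ shrink) ,
  small ∘ shrink
  where
  open SmallConnector
  shrink : ∀ i → SmallConnector G (D i) (Z i) (2 * V H ∸ 1)
  shrink i = smallConnector (inducedPath-length≤ forest free) (D-connected i) (Z⊆D i)
                               (proj₂ (nonempty i))
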